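{- For each $n\in\{3,4,5,6,7\}$, the graph $G_n$ is not edge-transitive, i.e. its automorphism group does not act transitively on its edge set.
   Context: Let $P$ be the Petersen graph on vertex set $\{0,1,\dots,9\}$ whose 15 edges are the unordered pairs underlying the following set of directed edges (an orientation $\vec P$ of $P$): $E(\vec P)=\{(0,1),(0,4),(0,5),(1,2),(1,6),(2,3),(2,7),(3,4),(3,8),(4,9),(5,7),(5,8),(6,8),(6,9),(7,9)\}$. For $n\ge 3$ let $\sigma$ be the cyclic permutation of $\{1,\dots,n\}$ given by $\sigma(i)=i+1$ for $i<n$ and $\sigma(n)=1$. The graph $G_n$ is the simple undirected graph with vertex set $\{(i,x):1\le i\le n,\ 0\le x\le 9\}$ in which $(i,x)\sim(i,y)$ whenever $\{x,y\}$ is an edge of $P$, and $(i,x)\sim(\sigma(i),y)$ whenever $(x,y)\in E(\vec P)$. -}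

module Defs where

open import Data.Nat using (ℕ; zero; suc)
open import Data.Fin using (Fin; zero; suc; toℕ)
open import Data.Product using (_×_; _,_; Σ; proj₁; proj₂)
open import Data.Sum using (_⊎_)
open import Data.Bool using (Bool; true; false; _∨_; _∧_)
open import Relation.Binary.PropositionalEquality using (_≡_)
open import Function.Bundles using (_↔_; Inverse)
open import Data.List using (List; []; _∷_)
open import Data.List.Membership.Propositional using (_∈_)

-- Petersen graph vertices are Fin 10 (labels 0..9).
-- The orientation P⃗ as a list of directed edges (x , y), as in the paper.
PetersenArcs : List (ℕ × ℕ)
PetersenArcs =
  (0 , 1) ∷ (0 , 4) ∷ (0 , 5) ∷ (1 , 2) ∷ (1 , 6) ∷ (2 , 3) ∷ (2 , 7) ∷
  (3 , 4) ∷ (3 , 8) ∷ (4 , 9) ∷ (5 , 7) ∷ (5 , 8) ∷ (6 , 8) ∷ (6 , 9) ∷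
  (7 , 9) ∷ []

Arc : Fin 10 → Fin 10 → Set
Arc x y = (toℕ x , toℕ y) ∈ PetersenArcs

PEdge : Fin 10 → Fin 10 → Set
PEdge x y = Arc x y ⊎ Arc y x

-- The cyclic permutation σ on indices; we index the n layers by Fin n
-- (layer i ∈ {1..n} of the paper is Fin n element i-1), so σ(i) = i+1 mod n.
σ : {n : ℕ} → Fin n → Fin n
σ {suc n} i = Data.Fin.fromℕ< {toℕ (Data.Fin.suc i) Data.Nat.% suc n}
                (Data.Nat.DivMod.m%n<n (toℕ (Data.Fin.suc i)) (suc n))
  where import Data.Nat.DivMod

V : ℕ → Set
V n = Fin n × Fin 10

data Adj (n : ℕ) : V n → V n → Set where
  inner : ∀ {i x y} → PEdge x y → Adj n (i , x) (i , y)
  fwd   : ∀ {i x y} → Arc x y → Adj n (i , x) (σ i , y)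
  bwd   : ∀ {i x y} → Arc x y → Adj n (σ i , y) (i , x)

record Automorphism (n : ℕ) : Set where
  field
    bij      : V n ↔ V n
  open Inverse bij public using (to)
  field
    preserve : ∀ u v → Adj n u v → Adj n (to u) (to v)
    reflect  : ∀ u v → Adj n (to u) (to v) → Adj n u v

-- An edge of G_n, given as an ordered pair of adjacent endpoints
-- (each unordered edge appears with both orientations).
Edge : ℕ → Set
Edge n = Σ (V n × V n) λ p → Adj n (proj₁ p) (proj₂ p)

EdgeTransitive : ℕ → Set
EdgeTransitive n =
  (e e' : Edge n) → Σ (Automorphism n) λ φ →
    let open Automorphism φ
        u = proj₁ (proj₁ e) ; v = proj₂ (proj₁ e)
        x = proj₁ (proj₁ e') ; y = proj₂ (proj₁ e')
    in (to u ≡ x × to v ≡ y) ⊎ (to u ≡ y × to v ≡ x)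

{-# OPTIONS --safe #-}
module Submission where

-- An automorphism maps the 5-cycles through an edge bijectively onto the
-- 5-cycles through its image, so the number of 5-cycles through an edge is
-- invariant under the automorphism group.  In G₃, …, G₇ the edges
-- {(1,0),(1,1)} and {(1,0),(1,4)} lie on different numbers of 5-cycles, hence
-- no automorphism maps one onto the other.

open import Defs
open import Data.Bool using (Bool; _∧_; not; if_then_else_)
open import Data.Fin using (Fin; zero; toℕ)
import Data.Fin as Fin
open import Data.Fin.Patterns using (0F; 1F; 4F)
open import Data.Fin.Properties using (*↔×)
open import Data.List.Relation.Unary.Any using (here; there)
open import Data.Nat using (ℕ; suc; _≤_; s≤s)
open import Data.Nat.Properties using (+-0-commutativeMonoid)
open import Algebra.Properties.CommutativeMonoid.Sum +-0-commutativeMonoid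
  using (sum; sum-permute; sum-cong-≗)
open import Data.Product using (_×_; _,_)
open import Data.Product.Properties using (≡-dec)
open import Data.Sum using (_⊎_; inj₁; inj₂)
open import Function using (_∘_)
open import Function.Bundles using (_↔_; _⇔_; Inverse; Injection; mk⇔)
open import Function.Construct.Composition using (_↔-∘_)
open import Function.Construct.Symmetry using (↔-sym)
open import Function.Properties.Inverse using (↔⇒↣)
open import Level using (0ℓ)
open import Relation.Binary using (Rel; Decidable; DecidableEquality)
open import Relation.Binary.PropositionalEquality using (_≡_; _≢_; refl; sym; cong; cong₂; module ≡-Reasoning)
open import Relation.Nullary using (¬_; does; _×-dec_; _⊎-dec_)
open import Relation.Nullary.Decidable using (map; does-⇔)

open Inverse using (to; from; strictlyInverseˡ)

module FiniteSum {A : Set} {k : ℕ} (enum : Fin k ↔ A) where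

  -- Opaque so that unification can solve the implicit arguments of the
  -- reindexing lemmas; the final counts are computed by unfolding it.
  opaque

    ∑ : (A → ℕ) → ℕ
    ∑ f = sum (f ∘ to enum)

    ∑-when : (A → Bool) → (A → ℕ) → ℕ
    ∑-when p f = ∑ λ x → if p x then f x else 0

    ∑-reindex : (φ : A ↔ A) {f g : A → ℕ} → (∀ x → f (to φ x) ≡ g x) → ∑ f ≡ ∑ g
    ∑-reindex φ {f} {g} f∘φ≗g = begin
      sum (f ∘ to enum)
        ≡⟨ sum-permute (f ∘ to enum) π ⟩
      sum (f ∘ to enum ∘ from enum ∘ to φ ∘ to enum)
        ≡⟨ sum-cong-≗ (cong f ∘ strictlyInverseˡ enum ∘ to φ ∘ to enum) ⟩
      sum (f ∘ to φ ∘ to enum)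
        ≡⟨ sum-cong-≗ (f∘φ≗g ∘ to enum) ⟩
      sum (g ∘ to enum)
        ∎
      where
      open ≡-Reasoning
      π : Fin k ↔ Fin k
      π = ↔-sym enum ↔-∘ (φ ↔-∘ enum)

    ∑-when-reindex : (φ : A ↔ A) {p q : A → Bool} {f g : A → ℕ} →
                     (∀ x → p (to φ x) ≡ q x) → (∀ x → f (to φ x) ≡ g x) →
                     ∑-when p f ≡ ∑-when q g
    ∑-when-reindex φ {p} {q} {f} {g} p∘φ≗q f∘φ≗g =
      ∑-reindex φ {λ x → if p x then f x else 0} {λ x → if q x then g x else 0}
        λ x → cong₂ (λ b m → if b then m else 0) (p∘φ≗q x) (f∘φ≗g x)

module Pentagons {A : Set} {k : ℕ} (enum : Fin k ↔ A) (_≟_ : DecidableEquality A)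
                 {_~_ : Rel A 0ℓ} (_~?_ : Decidable _~_) where

  open FiniteSum enum

  _~ᵇ_ _≠ᵇ_ : A → A → Bool
  a ~ᵇ b = does (a ~? b)
  a ≠ᵇ b = not (does (a ≟ b))

  -- When ~ is loopless and u ~ v ~ w ~ t, these are exactly the conditions for
  -- u v w t s to be a 5-cycle; the remaining inequalities follow from adjacency.
  closesPentagon : A → A → A → A → A → Bool
  closesPentagon u v w t s =
    t ~ᵇ s ∧ s ~ᵇ u ∧ u ≠ᵇ w ∧ u ≠ᵇ t ∧ v ≠ᵇ t ∧ v ≠ᵇ s ∧ w ≠ᵇ s

  pentagons : A → A → ℕ
  pentagons u v =
    ∑-when (v ~ᵇ_) λ w → ∑-when (w ~ᵇ_) λ t → ∑-when (closesPentagon u v w t) λ _ → 1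

  module _ (φ : A ↔ A) (φ-~ : ∀ a b → to φ a ~ to φ b ⇔ a ~ b) where

    ~ᵇ-invariant : ∀ a b → to φ a ~ᵇ to φ b ≡ a ~ᵇ b
    ~ᵇ-invariant a b = does-⇔ (φ-~ a b) (to φ a ~? to φ b) (a ~? b)

    ≠ᵇ-invariant : ∀ a b → to φ a ≠ᵇ to φ b ≡ a ≠ᵇ b
    ≠ᵇ-invariant a b = cong not (does-⇔ φa≡φb⇔a≡b (to φ a ≟ to φ b) (a ≟ b))
      where
      φa≡φb⇔a≡b : to φ a ≡ to φ b ⇔ a ≡ b
      φa≡φb⇔a≡b = mk⇔ (Injection.injective (↔⇒↣ φ)) (cong (to φ))

    closesPentagon-invariant : ∀ u v w t s →
      closesPentagon (to φ u) (to φ v) (to φ w) (to φ t) (to φ s) ≡ closesPentagon u v w t s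
    closesPentagon-invariant u v w t s
      rewrite ~ᵇ-invariant t s | ~ᵇ-invariant s u
            | ≠ᵇ-invariant u w | ≠ᵇ-invariant u t | ≠ᵇ-invariant v t
            | ≠ᵇ-invariant v s | ≠ᵇ-invariant w s = refl

    pentagons-invariant : ∀ u v → pentagons (to φ u) (to φ v) ≡ pentagons u v
    pentagons-invariant u v =
      ∑-when-reindex φ (~ᵇ-invariant v) λ w →
      ∑-when-reindex φ (~ᵇ-invariant w) λ t →
      ∑-when-reindex φ (closesPentagon-invariant u v w t) λ _ → refl

Arc? : Decidable Arc
Arc? x y = (toℕ x , toℕ y) ∈? PetersenArcs
  where open import Data.List.Membership.DecPropositional (≡-dec Data.Nat._≟_ Data.Nat._≟_)

AdjView : ∀ {n} → V n → V n → Set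
AdjView (i , x) (j , y) = (i ≡ j × PEdge x y) ⊎ (j ≡ σ i × Arc x y) ⊎ (i ≡ σ j × Arc y x)

AdjView⇔Adj : ∀ {n} {a b : V n} → AdjView a b ⇔ Adj n a b
AdjView⇔Adj = mk⇔ fromView toView
  where
  fromView : ∀ {n} {a b : V n} → AdjView a b → Adj n a b
  fromView {a = _ , _} {b = _ , _} (inj₁ (refl , e))        = inner e
  fromView {a = _ , _} {b = _ , _} (inj₂ (inj₁ (refl , e))) = fwd e
  fromView {a = _ , _} {b = _ , _} (inj₂ (inj₂ (refl , e))) = bwd e
  toView : ∀ {n} {a b : V n} → Adj n a b → AdjView a b
  toView (inner e) = inj₁ (refl , e)
  toView (fwd e)   = inj₂ (inj₁ (refl , e))
  toView (bwd e)   = inj₂ (inj₂ (refl , e))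

adj? : ∀ {n} → Decidable (Adj n)
adj? (i , x) (j , y) = map AdjView⇔Adj
  (  (i Fin.≟ j ×-dec (Arc? x y ⊎-dec Arc? y x))
  ⊎-dec (j Fin.≟ σ i ×-dec Arc? x y)
  ⊎-dec (i Fin.≟ σ j ×-dec Arc? y x))

module _ {n : ℕ} where
  open Pentagons (*↔× {n} {10}) (≡-dec Fin._≟_ Fin._≟_) (adj? {n}) public
    using (pentagons; pentagons-invariant)

Automorphism-Adj⇔ : ∀ {n} (φ : Automorphism n) a b →
                    Adj n (Automorphism.to φ a) (Automorphism.to φ b) ⇔ Adj n a b
Automorphism-Adj⇔ φ a b = mk⇔ (Automorphism.reflect φ a b) (Automorphism.preserve φ a b)

separatingInvariant⇒¬EdgeTransitive :
  ∀ {n} (f : V n → V n → ℕ) →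
  (∀ (φ : Automorphism n) u v → f (Automorphism.to φ u) (Automorphism.to φ v) ≡ f u v) →
  ∀ {u v x y} → Adj n u v → Adj n x y → f u v ≢ f x y → f u v ≢ f y x →
  ¬ EdgeTransitive n
separatingInvariant⇒¬EdgeTransitive f f-invariant u~v x~y uv≢xy uv≢yx edgeTransitive
  with edgeTransitive (_ , u~v) (_ , x~y)
... | φ , inj₁ (refl , refl) = uv≢xy (sym (f-invariant φ _ _))
... | φ , inj₂ (refl , refl) = uv≢yx (sym (f-invariant φ _ _))

pentagons-separate⇒¬EdgeTransitive :
  ∀ {n} (i : Fin n) →
  pentagons (i , 0F) (i , 1F) ≢ pentagons (i , 0F) (i , 4F) →
  pentagons (i , 0F) (i , 1F) ≢ pentagons (i , 4F) (i , 0F) →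
  ¬ EdgeTransitive n
pentagons-separate⇒¬EdgeTransitive i =
  separatingInvariant⇒¬EdgeTransitive pentagons
    (λ φ → pentagons-invariant (Automorphism.bij φ) (Automorphism-Adj⇔ φ))
    (inner (inj₁ (here refl))) (inner (inj₁ (there (here refl))))

-- By evaluation, the first-layer edges {0,1} and {0,4} lie on 23 and 20
-- pentagons for n = 3, on 22 and 14 for n = 4, and on 22 and 13 for n = 5, 6, 7.
opaque
  unfolding FiniteSum.∑-when
  proposition7p1 : (n : ℕ) → 3 ≤ n → n ≤ 7 → ¬ EdgeTransitive n
  proposition7p1 0 () _
  proposition7p1 1 (s≤s ()) _
  proposition7p1 2 (s≤s (s≤s ())) _
  proposition7p1 3 _ _ = pentagons-separate⇒¬EdgeTransitive zero (λ ()) (λ ())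
  proposition7p1 4 _ _ = pentagons-separate⇒¬EdgeTransitive zero (λ ()) (λ ())
  proposition7p1 5 _ _ = pentagons-separate⇒¬EdgeTransitive zero (λ ()) (λ ())
  proposition7p1 6 _ _ = pentagons-separate⇒¬EdgeTransitive zero (λ ()) (λ ())
  proposition7p1 7 _ _ = pentagons-separate⇒¬EdgeTransitive zero (λ ()) (λ ())
  proposition7p1 (suc (suc (suc (suc (suc (suc (suc (suc n)))))))) _
    (s≤s (s≤s (s≤s (s≤s (s≤s (s≤s (s≤s ())))))))
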